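{- Let $n$ be a positive integer divisible by $8$ and $1\le k_1\le n/2$. Let $\mathcal{C}_1\subset\mathcal{C}_2\subset\mathcal{C}_1^\perp$ be binary codes of length $n$ with generator matrices $\begin{bmatrix}1&\mathbf{1}&\mathbf{1}\\0&I_{k_1-1}&A\end{bmatrix}$ and $\begin{bmatrix}1&\mathbf{1}&\mathbf{1}\\0&I_{k_1-1}&A\\0&0&B\end{bmatrix}$, where $A\in M_{(k_1-1)\times(n-k_1)}(\mathbf{Z})$, $B\in M_{k_2\times(n-k_1)}(\mathbf{Z})$, $\dim\mathcal{C}_1=k_1$, $\dim\mathcal{C}_2=k_1+k_2$, and $\mathcal{C}_1$ is doubly even. Let $Y$ be the set of quaternary even codes $\mathcal{C}$ of length $n$ with $\pi(\mathcal{C})=\iota^{ -1}(\mathcal{C})=\mathcal{C}_1$ and $\mathbf{1}\in\mathcal{C}$, and $Y'$ the set of quaternary even codes $\mathcal{C}'$ of length $n$ with $\pi(\mathcal{C}')=\mathcal{C}_1$, $\iota^{ -1}(\mathcal{C}')=\mathcal{C}_2$ and $\mathbf{1}\in\mathcal{C}'$. Then for every $\mathcal{C}'\in Y'$, $|\{\mathcal{C}\in Y:\mathcal{C}\subset\mathcal{C}'\}|=2^{(k_1-1)k_2}$.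
   Context: $\mathbf{1}$ denotes an all-ones vector of the appropriate length. An integer matrix $G\in M_{k\times n}(\mathbf{Z})$ is a generator matrix of the code $\mathcal{C}$ over $\mathbf{Z}_m$ if $\mathcal{C}=\{aG\bmod m:a\in\mathbf{Z}^k\}$. Duals are with respect to the standard inner product. A binary code is doubly even if all Hamming weights are divisible by $4$. The Euclidean weight on $\mathbf{Z}_4$ is $\mathrm{wt}_e(0)=0$, $\mathrm{wt}_e(\pm1)=1$, $\mathrm{wt}_e(2)=4$, extended additively; a quaternary code is even if all codewords have Euclidean weight divisible by $8$. $\pi:\mathbf{Z}_4^n\to\mathbf{Z}_2^n$ is reduction mod $2$ and $\iota:\mathbf{Z}_2^n\to\mathbf{Z}_4^n$ is $x\mapsto2x$. -}

module Defs where

open import Data.Nat as ℕ using (ℕ; zero; suc)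
open import Data.Nat.Divisibility using (_∣_)
open import Data.Nat.DivMod using (_mod_)
open import Data.Integer as ℤ using (ℤ; +_)
open import Data.Integer.DivMod using (_%ℕ_)
open import Data.Fin using (Fin; zero; suc; toℕ)
open import Data.Vec using (Vec; []; _∷_; _++_; replicate; tabulate; zipWith; map; foldr; lookup)
open import Data.Bool using (Bool; true; false)
open import Data.Product using (Σ; ∃; _×_; _,_)
open import Relation.Binary.PropositionalEquality using (_≡_)

Z₂ Z₄ : Set
Z₂ = Fin 2
Z₄ = Fin 4

BWord QWord : ℕ → Set
BWord n = Vec Z₂ n
QWord n = Vec Z₄ n

_+₄_ _*₄_ : Z₄ → Z₄ → Z₄
a +₄ b = (toℕ a ℕ.+ toℕ b) mod 4
a *₄ b = (toℕ a ℕ.* toℕ b) mod 4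

_⊕_ : ∀ {n} → QWord n → QWord n → QWord n
_⊕_ = zipWith _+₄_

_·_ : ∀ {n} → Z₄ → QWord n → QWord n
a · x = map (a *₄_) x

zero₄ : ∀ {n} → QWord n
zero₄ = replicate _ zero

ones₄ : ∀ {n} → QWord n
ones₄ = replicate _ (suc zero)

wtₑ₁ : Z₄ → ℕ
wtₑ₁ zero = 0
wtₑ₁ (suc zero) = 1
wtₑ₁ (suc (suc zero)) = 4
wtₑ₁ (suc (suc (suc zero))) = 1

wtₑ : ∀ {n} → QWord n → ℕ
wtₑ = foldr _ (λ a s → wtₑ₁ a ℕ.+ s) 0

wtH₁ : Z₂ → ℕ
wtH₁ zero = 0
wtH₁ (suc _) = 1

wtH : ∀ {n} → BWord n → ℕ
wtH = foldr _ (λ a s → wtH₁ a ℕ.+ s) 0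

π : ∀ {n} → QWord n → BWord n
π = map (λ a → toℕ a mod 2)

ι : ∀ {n} → BWord n → QWord n
ι = map (λ b → (2 ℕ.* toℕ b) mod 4)

QCode : ℕ → Set
QCode n = QWord n → Bool

_∈Q_ : ∀ {n} → QWord n → QCode n → Set
x ∈Q C = C x ≡ true

_≐_ : ∀ {n} → QCode n → QCode n → Set
C ≐ D = ∀ x → C x ≡ D x

_⊆Q_ : ∀ {n} → QCode n → QCode n → Set
C ⊆Q D = ∀ x → x ∈Q C → x ∈Q D

IsQuaternaryCode : ∀ {n} → QCode n → Set
IsQuaternaryCode C =
  (zero₄ ∈Q C)
  × (∀ x y → x ∈Q C → y ∈Q C → (x ⊕ y) ∈Q C)
  × (∀ a x → x ∈Q C → (a · x) ∈Q C)

IsEven : ∀ {n} → QCode n → Set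
IsEven C = ∀ x → x ∈Q C → 8 ∣ wtₑ x

BCode : ℕ → Set₁
BCode n = BWord n → Set

πImage≡ : ∀ {n} → QCode n → BCode n → Set
πImage≡ {n} C D = ∀ (v : BWord n) → ((∃ λ x → x ∈Q C × π x ≡ v) → D v) × (D v → ∃ λ x → x ∈Q C × π x ≡ v)

ιPreimage≡ : ∀ {n} → QCode n → BCode n → Set
ιPreimage≡ {n} C D = ∀ (v : BWord n) → (ι v ∈Q C → D v) × (D v → ι v ∈Q C)

IMat : ℕ → ℕ → Set
IMat k n = Vec (Vec ℤ n) k

lincomb : ∀ {k n} → (Fin k → ℤ) → IMat k n → Vec ℤ n
lincomb {n = n} a [] = replicate n (+ 0)
lincomb a (r ∷ G) = zipWith ℤ._+_ (map (a zero ℤ.*_) r) (lincomb (λ i → a (suc i)) G)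

mod2 : ∀ {n} → Vec ℤ n → BWord n
mod2 = map (λ z → (z %ℕ 2) mod 2)

BinGen : ∀ {k n} → IMat k n → BCode n
BinGen G v = ∃ λ a → mod2 (lincomb a G) ≡ v

-- rows of G linearly independent over Z₂ (i.e. dim ⟨G⟩ = k)
RowsIndep₂ : ∀ {k n} → IMat k n → Set
RowsIndep₂ {k} {n} G = ∀ (a : Fin k → ℤ) → mod2 (lincomb a G) ≡ replicate n zero → ∀ i → (a i %ℕ 2) ≡ 0

dotℕ : ∀ {n} → BWord n → BWord n → ℕ
dotℕ u v = foldr _ ℕ._+_ 0 (zipWith (λ a b → toℕ a ℕ.* toℕ b) u v)

Orth₂ : ∀ {n} → BWord n → BWord n → Set
Orth₂ u v = 2 ∣ dotℕ u v

⊆Dual : ∀ {n} → BCode n → BCode n → Set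
⊆Dual {n} D E = ∀ (u v : BWord n) → D u → E v → Orth₂ u v

-- The block generator matrices of the statement.
-- k₁ = suc j,  n = suc (j + r)  (so r = n - k₁)

δ : ∀ {m} → Fin m → Fin m → ℤ
δ zero zero = + 1
δ zero (suc _) = + 0
δ (suc _) zero = + 0
δ (suc i) (suc i') = δ i i'

G₁ : ∀ {j r} → (Fin j → Fin r → ℤ) → IMat (suc j) (suc (j ℕ.+ r))
G₁ {j} {r} A = ((+ 1) ∷ (replicate j (+ 1) ++ replicate r (+ 1)))
             ∷ tabulate (λ i → (+ 0) ∷ (tabulate (δ i) ++ tabulate (A i)))

G₂ : ∀ {j r k₂} → (Fin j → Fin r → ℤ) → (Fin k₂ → Fin r → ℤ)
   → IMat (suc j ℕ.+ k₂) (suc (j ℕ.+ r))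
G₂ {j} {r} A B = G₁ A ++ tabulate (λ i → (+ 0) ∷ (replicate j (+ 0) ++ tabulate (B i)))

HasCard : ∀ {n} → (QCode n → Set) → ℕ → Set
HasCard {n} P m =
  Σ (Fin m → QCode n) λ f →
    (∀ i → P (f i))
    × (∀ i i' → f i ≐ f i' → i ≡ i')
    × (∀ C → P C → ∃ λ i → f i ≐ C)

InY : ∀ {n} → BCode n → BCode n → QCode n → Set
InY D₁ D₂ C = IsQuaternaryCode C × IsEven C × πImage≡ C D₁ × ιPreimage≡ C D₂ × (ones₄ ∈Q C)

-- Fix lifts x̃₁, …, x̃ⱼ ∈ 𝒞′ of the rows of G₁ other than 𝟏 (j = k₁ − 1). For every binary
-- j × k₂ matrix t, the words 𝟏, x̃ᵢ + 2tᵢB and 2G₁ generate a code 𝒞ₜ with π(𝒞ₜ) = ι⁻¹(𝒞ₜ) = 𝒞₁;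
-- it lies in 𝒞′, hence is even, and it determines t because the rows of G₂ are independent mod 2.
-- Conversely, if 𝒞 ∈ Y and 𝒞 ⊆ 𝒞′, a lift z ∈ 𝒞 of row i of G₁ has z − x̃ᵢ ∈ 2𝒞₂ = 2(𝒞₁ + ⟨B⟩),
-- so x̃ᵢ + 2tᵢB ∈ 𝒞 for some tᵢ, and then 𝒞 = 𝒞ₜ. So Y ∩ {𝒞 ⊆ 𝒞′} is in bijection with the 2^{jk₂}
-- matrices t.

module Submission where

open import Defs
open import Data.Nat using (ℕ; suc; _+_; _*_; _^_; _≤_; _/_)
open import Data.Nat.Divisibility using (_∣_)
open import Data.Integer using (ℤ)
open import Data.Fin using (Fin)
open import Data.Product using (_×_)
open import Level using (0ℓ)
open import Data.Nat as ℕ using (zero)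
import Data.Nat.Properties as ℕₚ
open import Data.Nat.DivMod using (_mod_; _%_; m%n<n; [m+n]%n≡m%n)
open import Data.Integer as ℤ using (+_; -[1+_]; _⊖_; ∣_∣)
import Data.Integer.Properties as ℤₚ
open import Data.Integer.DivMod using (_%ℕ_)
open import Data.Fin using (zero; suc; toℕ; _≟_; _↑ˡ_; _↑ʳ_)
open import Data.Fin.Patterns using (0F; 1F; 2F; 3F)
open import Data.Fin.Base using (finToFun; funToFin; combine; remQuot)
open import Data.Fin.Properties using (all?; funToFin-finToFin; finToFun-funToFin; combine-remQuot; remQuot-combine)
open import Data.Vec using (Vec; []; _∷_; replicate; zipWith; map; lookup; tabulate; _++_)
open import Data.Vec.Properties
  using (zipWith-assoc; zipWith-comm; zipWith-identityˡ; zipWith-identityʳ; zipWith-inverseˡ; zipWith-inverseʳ;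
         map-∘; map-cong; map-id; map-const; map-replicate; map-++; ∷-injectiveˡ; ∷-injectiveʳ;
         lookup-zipWith; lookup-map; lookup-replicate; lookup-++ˡ; lookup∘tabulate; ≡-dec)
import Data.Vec.Functional as Vector
open import Data.Vec.Functional.Properties using () renaming (lookup-++ˡ to ++ᶠ-↑ˡ; lookup-++ʳ to ++ᶠ-↑ʳ)
open import Data.Bool using (true)
open import Data.Bool.Properties using (⇔→≡)
open import Data.Product using (∃; ∃₂; _,_; proj₁; proj₂; uncurry)
open import Function using (_∘_; id)
open import Function.Bundles using (mk⇔)
open import Algebra.Bundles using (AbelianGroup)
import Algebra.Properties.AbelianGroup as AbelianGroupProperties
import Algebra.Properties.CommutativeSemigroup as CommutativeSemigroupProperties
open import Relation.Nullary using (yes; does)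
open import Relation.Nullary.Decidable using (True; toWitness; dec-true)
open import Relation.Binary.PropositionalEquality

exhaustive₁ : ∀ {k l} {f g : Fin k → Fin l} → True (all? λ a → f a ≟ g a) → ∀ a → f a ≡ g a
exhaustive₁ h = toWitness h

exhaustive₂ : ∀ {k l m} {f g : Fin k → Fin l → Fin m}
  → True (all? λ a → all? λ b → f a b ≟ g a b) → ∀ a b → f a b ≡ g a b
exhaustive₂ h = toWitness h

exhaustive₃ : ∀ {k l m o} {f g : Fin k → Fin l → Fin m → Fin o}
  → True (all? λ a → all? λ b → all? λ c → f a b c ≟ g a b c) → ∀ a b c → f a b c ≡ g a b c
exhaustive₃ h = toWitness h

infixl 7 _&_
infixl 6 _⊻_

_⊻_ _&_ : Z₂ → Z₂ → Z₂
0F ⊻ b = b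
1F ⊻ 0F = 1F
1F ⊻ 1F = 0F
0F & b = 0F
1F & b = b

⊻-assoc : ∀ a b c → (a ⊻ b) ⊻ c ≡ a ⊻ (b ⊻ c)
⊻-assoc = exhaustive₃ _

⊻-comm : ∀ a b → a ⊻ b ≡ b ⊻ a
⊻-comm = exhaustive₂ _

⊻-identityʳ : ∀ a → a ⊻ 0F ≡ a
⊻-identityʳ = exhaustive₁ _

⊻-self : ∀ a → a ⊻ a ≡ 0F
⊻-self = exhaustive₁ _

⊻-cancelˡ : ∀ a b → a ⊻ (a ⊻ b) ≡ b
⊻-cancelˡ = exhaustive₂ _

⊻≡0⇒≡ : ∀ {a b} → a ⊻ b ≡ 0F → a ≡ b
⊻≡0⇒≡ {a} {b} e = trans (sym (⊻-identityʳ a)) (trans (cong (a ⊻_) (sym e)) (⊻-cancelˡ a b))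

&-distribʳ-⊻ : ∀ a b c → (a ⊻ b) & c ≡ a & c ⊻ b & c
&-distribʳ-⊻ = exhaustive₃ _

&-zeroʳ : ∀ a → a & 0F ≡ 0F
&-zeroʳ = exhaustive₁ _

&-identityʳ : ∀ a → a & 1F ≡ a
&-identityʳ = exhaustive₁ _

1F⊻-involutive : ∀ a → 1F ⊻ (1F ⊻ a) ≡ a
1F⊻-involutive = exhaustive₁ _

1F⊻-cancel : ∀ a b → (1F ⊻ a) ⊻ (1F ⊻ b) ≡ a ⊻ b
1F⊻-cancel = exhaustive₂ _

parityℕ : ℕ → Z₂
parityℕ zero = 0F
parityℕ (suc n) = 1F ⊻ parityℕ n

parityℕ-+ : ∀ m n → parityℕ (m + n) ≡ parityℕ m ⊻ parityℕ n
parityℕ-+ zero n = refl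
parityℕ-+ (suc m) n = trans (cong (1F ⊻_) (parityℕ-+ m n)) (sym (⊻-assoc 1F (parityℕ m) (parityℕ n)))

parityℕ-* : ∀ m n → parityℕ (m * n) ≡ parityℕ m & parityℕ n
parityℕ-* zero n = refl
parityℕ-* (suc m) n = begin
  parityℕ (n + m * n)                   ≡⟨ parityℕ-+ n (m * n) ⟩
  parityℕ n ⊻ parityℕ (m * n)           ≡⟨ cong (parityℕ n ⊻_) (parityℕ-* m n) ⟩
  parityℕ n ⊻ parityℕ m & parityℕ n     ≡⟨ sym (&-distribʳ-⊻ 1F (parityℕ m) (parityℕ n)) ⟩
  (1F ⊻ parityℕ m) & parityℕ n          ∎
  where open ≡-Reasoning

parityℤ : ℤ → Z₂
parityℤ z = parityℕ ∣ z ∣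

parityℤ-⊖ : ∀ m n → parityℤ (m ⊖ n) ≡ parityℕ m ⊻ parityℕ n
parityℤ-⊖ m zero = sym (⊻-identityʳ (parityℕ m))
parityℤ-⊖ zero (suc n) = refl
parityℤ-⊖ (suc m) (suc n) = begin
  parityℤ (suc m ⊖ suc n)          ≡⟨ cong parityℤ (ℤₚ.[1+m]⊖[1+n]≡m⊖n m n) ⟩
  parityℤ (m ⊖ n)                  ≡⟨ parityℤ-⊖ m n ⟩
  parityℕ m ⊻ parityℕ n            ≡⟨ sym (1F⊻-cancel (parityℕ m) (parityℕ n)) ⟩
  (1F ⊻ parityℕ m) ⊻ (1F ⊻ parityℕ n) ∎
  where open ≡-Reasoning

parityℤ-+ : ∀ x y → parityℤ (x ℤ.+ y) ≡ parityℤ x ⊻ parityℤ y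
parityℤ-+ -[1+ m ] -[1+ n ] = begin
  1F ⊻ (1F ⊻ parityℕ (m + n))          ≡⟨ 1F⊻-involutive (parityℕ (m + n)) ⟩
  parityℕ (m + n)                      ≡⟨ parityℕ-+ m n ⟩
  parityℕ m ⊻ parityℕ n                ≡⟨ sym (1F⊻-cancel (parityℕ m) (parityℕ n)) ⟩
  (1F ⊻ parityℕ m) ⊻ (1F ⊻ parityℕ n)  ∎
  where open ≡-Reasoning
parityℤ-+ -[1+ m ] (+ n) = trans (parityℤ-⊖ n (suc m)) (⊻-comm (parityℕ n) _)
parityℤ-+ (+ m) -[1+ n ] = parityℤ-⊖ m (suc n)
parityℤ-+ (+ m) (+ n) = parityℕ-+ m n

parityℤ-* : ∀ x y → parityℤ (x ℤ.* y) ≡ parityℤ x & parityℤ y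
parityℤ-* x y = trans (cong parityℕ (ℤₚ.abs-◃ _ (∣ x ∣ * ∣ y ∣))) (parityℕ-* ∣ x ∣ ∣ y ∣)

%2-parityℕ : ∀ n → n % 2 mod 2 ≡ parityℕ n
%2-parityℕ 0 = refl
%2-parityℕ 1 = refl
%2-parityℕ (suc (suc n)) = begin
  suc (suc n) % 2 mod 2    ≡⟨ cong (λ m → m % 2 mod 2) (ℕₚ.+-comm 2 n) ⟩
  (n + 2) % 2 mod 2        ≡⟨ cong (_mod 2) ([m+n]%n≡m%n n 2) ⟩
  n % 2 mod 2              ≡⟨ %2-parityℕ n ⟩
  parityℕ n                ≡⟨ sym (1F⊻-involutive (parityℕ n)) ⟩
  1F ⊻ (1F ⊻ parityℕ n)    ∎
  where open ≡-Reasoning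

%ℕ2≡∣∣%2 : ∀ z → z %ℕ 2 ≡ ∣ z ∣ % 2
%ℕ2≡∣∣%2 (+ n) = refl
%ℕ2≡∣∣%2 -[1+ n ] with suc n % 2 | m%n<n (suc n) 2
... | 0 | _ = refl
... | 1 | _ = refl
... | suc (suc _) | ℕ.s≤s (ℕ.s≤s ())

reduce₂ : ℤ → Z₂
reduce₂ z = (z %ℕ 2) mod 2

reduce₂≡parityℤ : ∀ z → reduce₂ z ≡ parityℤ z
reduce₂≡parityℤ z = trans (cong (_mod 2) (%ℕ2≡∣∣%2 z)) (%2-parityℕ ∣ z ∣)

π₁ : Z₄ → Z₂
π₁ a = toℕ a mod 2

ι₁ : Z₂ → Z₄
ι₁ b = (2 * toℕ b) mod 4

neg₄ : Z₄ → Z₄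
neg₄ 0F = 0F
neg₄ 1F = 3F
neg₄ 2F = 2F
neg₄ 3F = 1F

half : Z₄ → Z₂
half 0F = 0F
half 1F = 0F
half 2F = 1F
half 3F = 1F

+₄-assoc : ∀ a b c → (a +₄ b) +₄ c ≡ a +₄ (b +₄ c)
+₄-assoc = exhaustive₃ _

+₄-comm : ∀ a b → a +₄ b ≡ b +₄ a
+₄-comm = exhaustive₂ _

+₄-identityˡ : ∀ a → 0F +₄ a ≡ a
+₄-identityˡ = exhaustive₁ _

+₄-identityʳ : ∀ a → a +₄ 0F ≡ a
+₄-identityʳ = exhaustive₁ _

+₄-inverseˡ : ∀ a → neg₄ a +₄ a ≡ 0F
+₄-inverseˡ = exhaustive₁ _

+₄-inverseʳ : ∀ a → a +₄ neg₄ a ≡ 0F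
+₄-inverseʳ = exhaustive₁ _

π₁-+₄ : ∀ a b → π₁ (a +₄ b) ≡ π₁ a ⊻ π₁ b
π₁-+₄ = exhaustive₂ _

ι₁-⊻ : ∀ a b → ι₁ (a ⊻ b) ≡ ι₁ a +₄ ι₁ b
ι₁-⊻ = exhaustive₂ _

π₁∘ι₁ : ∀ a → π₁ (ι₁ a) ≡ 0F
π₁∘ι₁ = exhaustive₁ _

half∘ι₁ : ∀ a → half (ι₁ a) ≡ a
half∘ι₁ = exhaustive₁ _

π₁∘neg₄ : ∀ a → π₁ (neg₄ a) ≡ π₁ a
π₁∘neg₄ = exhaustive₁ _

+₄-self : ∀ a → a +₄ a ≡ ι₁ (π₁ a)
+₄-self = exhaustive₁ _

π₁≡0⇒ι₁∘half : ∀ a → π₁ a ≡ 0F → ι₁ (half a) ≡ a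
π₁≡0⇒ι₁∘half 0F _ = refl
π₁≡0⇒ι₁∘half 1F ()
π₁≡0⇒ι₁∘half 2F _ = refl
π₁≡0⇒ι₁∘half 3F ()

infixl 6 _⊻ᵥ_

_⊻ᵥ_ : ∀ {n} → BWord n → BWord n → BWord n
_⊻ᵥ_ = zipWith _⊻_

zero₂ : ∀ {n} → BWord n
zero₂ = replicate _ 0F

negᵥ : ∀ {n} → QWord n → QWord n
negᵥ = map neg₄

⊻ᵥ-self : ∀ {n} (x : BWord n) → x ⊻ᵥ x ≡ zero₂
⊻ᵥ-self [] = refl
⊻ᵥ-self (a ∷ x) = cong₂ _∷_ (⊻-self a) (⊻ᵥ-self x)

bword-abelianGroup : ℕ → AbelianGroup 0ℓ 0ℓ
bword-abelianGroup n = record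
  { Carrier = BWord n ; _≈_ = _≡_ ; _∙_ = _⊻ᵥ_ ; ε = zero₂ ; _⁻¹ = id
  ; isAbelianGroup = record
    { isGroup = record
      { isMonoid = record
        { isSemigroup = record
          { isMagma = record { isEquivalence = isEquivalence ; ∙-cong = cong₂ _⊻ᵥ_ }
          ; assoc = zipWith-assoc ⊻-assoc }
        ; identity = zipWith-identityˡ (λ _ → refl) , zipWith-identityʳ ⊻-identityʳ }
      ; inverse = ⊻ᵥ-self , ⊻ᵥ-self
      ; ⁻¹-cong = λ e → e }
    ; comm = zipWith-comm ⊻-comm } }

qword-abelianGroup : ℕ → AbelianGroup 0ℓ 0ℓ
qword-abelianGroup n = record
  { Carrier = QWord n ; _≈_ = _≡_ ; _∙_ = _⊕_ ; ε = zero₄ ; _⁻¹ = negᵥ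
  ; isAbelianGroup = record
    { isGroup = record
      { isMonoid = record
        { isSemigroup = record
          { isMagma = record { isEquivalence = isEquivalence ; ∙-cong = cong₂ _⊕_ }
          ; assoc = zipWith-assoc +₄-assoc }
        ; identity = zipWith-identityˡ +₄-identityˡ , zipWith-identityʳ +₄-identityʳ }
      ; inverse = zipWith-inverseˡ +₄-inverseˡ , zipWith-inverseʳ +₄-inverseʳ
      ; ⁻¹-cong = cong negᵥ }
    ; comm = zipWith-comm +₄-comm } }

module BW {n : ℕ} = AbelianGroup (bword-abelianGroup n)
module QW {n : ℕ} = AbelianGroup (qword-abelianGroup n)

module _ {A B : Set} where

  map-zipWith : ∀ {f : A → B} {g : A → A → A} {h : B → B → B} → (∀ a b → f (g a b) ≡ h (f a) (f b))
    → ∀ {n} (xs ys : Vec A n) → map f (zipWith g xs ys) ≡ zipWith h (map f xs) (map f ys)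
  map-zipWith hom [] [] = refl
  map-zipWith hom (x ∷ xs) (y ∷ ys) = cong₂ _∷_ (hom x y) (map-zipWith hom xs ys)

  map-∘-cong : ∀ {C : Set} {f : B → C} {g : A → B} {h : A → C} → (∀ a → f (g a) ≡ h a)
    → ∀ {n} (xs : Vec A n) → map f (map g xs) ≡ map h xs
  map-∘-cong {f = f} {g} eq xs = trans (sym (map-∘ f g xs)) (map-cong eq xs)

  map-as-zipWith : ∀ {f : A → B} {g : A → B → B} {h : A → B} → (∀ a → f a ≡ g a (h a))
    → ∀ {n} (xs : Vec A n) → map f xs ≡ zipWith g xs (map h xs)
  map-as-zipWith eq [] = refl
  map-as-zipWith eq (x ∷ xs) = cong₂ _∷_ (eq x) (map-as-zipWith eq xs)

halfᵥ : ∀ {n} → QWord n → BWord n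
halfᵥ = map half

module _ {n : ℕ} where

  π-⊕ : ∀ (x y : QWord n) → π (x ⊕ y) ≡ π x ⊻ᵥ π y
  π-⊕ = map-zipWith π₁-+₄

  ι-⊻ᵥ : ∀ (x y : BWord n) → ι (x ⊻ᵥ y) ≡ ι x ⊕ ι y
  ι-⊻ᵥ = map-zipWith ι₁-⊻

  π∘ι : ∀ (x : BWord n) → π (ι x) ≡ zero₂
  π∘ι x = trans (map-∘-cong π₁∘ι₁ x) (map-const x 0F)

  π-negᵥ : ∀ (x : QWord n) → π (negᵥ x) ≡ π x
  π-negᵥ = map-∘-cong π₁∘neg₄

  halfᵥ∘ι : ∀ (x : BWord n) → halfᵥ (ι x) ≡ x
  halfᵥ∘ι x = trans (map-∘-cong half∘ι₁ x) (map-id x)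

  ι-injective : ∀ {x y : BWord n} → ι x ≡ ι y → x ≡ y
  ι-injective {x} {y} e = trans (sym (halfᵥ∘ι x)) (trans (cong halfᵥ e) (halfᵥ∘ι y))

  ι-zero₂ : ι (zero₂ {n}) ≡ zero₄
  ι-zero₂ = map-replicate _ 0F n

  π-zero₄ : π (zero₄ {n}) ≡ zero₂
  π-zero₄ = map-replicate _ 0F n

π≡0⇒ι∘halfᵥ : ∀ {n} (x : QWord n) → π x ≡ zero₂ → ι (halfᵥ x) ≡ x
π≡0⇒ι∘halfᵥ [] _ = refl
π≡0⇒ι∘halfᵥ (a ∷ x) e = cong₂ _∷_ (π₁≡0⇒ι₁∘half a (∷-injectiveˡ e)) (π≡0⇒ι∘halfᵥ x (∷-injectiveʳ e))

·-zero : ∀ {n} (x : QWord n) → 0F · x ≡ zero₄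
·-zero x = trans (map-cong (exhaustive₁ {f = 0F *₄_} _) x) (map-const x 0F)

·-suc : ∀ {n} a (x : QWord n) → (a +₄ 1F) · x ≡ x ⊕ (a · x)
·-suc a = map-as-zipWith (exhaustive₂ {f = λ a b → (a +₄ 1F) *₄ b} {g = λ a b → b +₄ (a *₄ b)} _ a)

negᵥ≡3· : ∀ {n} (x : QWord n) → negᵥ x ≡ 3F · x
negᵥ≡3· = map-cong (exhaustive₁ _)

⊕-self : ∀ {n} (x : QWord n) → x ⊕ x ≡ ι (π x)
⊕-self [] = refl
⊕-self (a ∷ x) = cong₂ _∷_ (+₄-self a) (⊕-self x)

module BWP {n : ℕ} = AbelianGroupProperties (bword-abelianGroup n)
module QWP {n : ℕ} = AbelianGroupProperties (qword-abelianGroup n)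
module BWS {n : ℕ} = CommutativeSemigroupProperties (BW.commutativeSemigroup {n})
module QWS {n : ℕ} = CommutativeSemigroupProperties (QW.commutativeSemigroup {n})

infixr 7 _·₂_

_·₂_ : ∀ {n} → Z₂ → BWord n → BWord n
b ·₂ v = map (b &_) v

module _ {n : ℕ} where

  ·₂-zero : ∀ (v : BWord n) → 0F ·₂ v ≡ zero₂
  ·₂-zero v = map-const v 0F

  ·₂-one : ∀ (v : BWord n) → 1F ·₂ v ≡ v
  ·₂-one = map-id

·₂-distrib-⊻ : ∀ {n} a b (v : BWord n) → (a ⊻ b) ·₂ v ≡ a ·₂ v ⊻ᵥ b ·₂ v
·₂-distrib-⊻ a b [] = refl
·₂-distrib-⊻ a b (x ∷ v) = cong₂ _∷_ (&-distribʳ-⊻ a b x) (·₂-distrib-⊻ a b v)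

lincomb₂ : ∀ {k n} → (Fin k → Z₂) → (Fin k → BWord n) → BWord n
lincomb₂ {zero} a R = zero₂
lincomb₂ {suc k} a R = a 0F ·₂ R 0F ⊻ᵥ lincomb₂ (a ∘ suc) (R ∘ suc)

lincomb₂-cong : ∀ {k n} {a b : Fin k → Z₂} {R S : Fin k → BWord n}
  → (∀ i → a i ≡ b i) → (∀ i → R i ≡ S i) → lincomb₂ a R ≡ lincomb₂ b S
lincomb₂-cong {zero} ea eR = refl
lincomb₂-cong {suc k} ea eR = cong₂ _⊻ᵥ_ (cong₂ _·₂_ (ea 0F) (eR 0F)) (lincomb₂-cong (ea ∘ suc) (eR ∘ suc))

lincomb₂-zero : ∀ {k n} (R : Fin k → BWord n) → lincomb₂ (λ _ → 0F) R ≡ zero₂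
lincomb₂-zero {zero} R = refl
lincomb₂-zero {suc k} R = trans (cong₂ _⊻ᵥ_ (·₂-zero (R 0F)) (lincomb₂-zero (R ∘ suc))) (BW.identityˡ zero₂)

lincomb₂-⊻ : ∀ {k n} (a b : Fin k → Z₂) (R : Fin k → BWord n)
  → lincomb₂ (λ i → a i ⊻ b i) R ≡ lincomb₂ a R ⊻ᵥ lincomb₂ b R
lincomb₂-⊻ {zero} a b R = sym (BW.identityˡ zero₂)
lincomb₂-⊻ {suc k} a b R = trans
  (cong₂ _⊻ᵥ_ (·₂-distrib-⊻ (a 0F) (b 0F) (R 0F)) (lincomb₂-⊻ (a ∘ suc) (b ∘ suc) (R ∘ suc)))
  (BWS.interchange _ _ _ _)

e₂ : ∀ {k} → Fin k → Fin k → Z₂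
e₂ zero zero = 1F
e₂ zero (suc _) = 0F
e₂ (suc _) zero = 0F
e₂ (suc i) (suc i') = e₂ i i'

lincomb₂-e₂ : ∀ {k n} (i : Fin k) (R : Fin k → BWord n) → lincomb₂ (e₂ i) R ≡ R i
lincomb₂-e₂ zero R = trans (cong₂ _⊻ᵥ_ (·₂-one (R 0F)) (lincomb₂-zero (R ∘ suc))) (BW.identityʳ (R 0F))
lincomb₂-e₂ (suc i) R = trans (cong₂ _⊻ᵥ_ (·₂-zero (R 0F)) (lincomb₂-e₂ i (R ∘ suc))) (BW.identityˡ (R (suc i)))

lincomb₂-++ : ∀ {m k n} (a : Fin (m + k) → Z₂) (R : Fin (m + k) → BWord n)
  → lincomb₂ a R ≡ lincomb₂ (λ i → a (i ↑ˡ k)) (λ i → R (i ↑ˡ k)) ⊻ᵥ lincomb₂ (λ i → a (m ↑ʳ i)) (λ i → R (m ↑ʳ i))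
lincomb₂-++ {zero} a R = sym (BW.identityˡ _)
lincomb₂-++ {suc m} {k} a R = trans (cong (a 0F ·₂ R 0F ⊻ᵥ_) (lincomb₂-++ {m} {k} (a ∘ suc) (R ∘ suc))) (sym (BW.assoc _ _ _))

sum₂ : ∀ {k} → (Fin k → Z₂) → Z₂
sum₂ {zero} f = 0F
sum₂ {suc k} f = f 0F ⊻ sum₂ (f ∘ suc)

lookup-lincomb₂ : ∀ {k n} (a : Fin k → Z₂) (R : Fin k → BWord n) (m : Fin n)
  → lookup (lincomb₂ a R) m ≡ sum₂ (λ i → a i & lookup (R i) m)
lookup-lincomb₂ {zero} a R m = lookup-replicate m 0F
lookup-lincomb₂ {suc k} a R m = trans
  (lookup-zipWith _⊻_ m (a 0F ·₂ R 0F) (lincomb₂ (a ∘ suc) (R ∘ suc)))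
  (cong₂ _⊻_ (lookup-map m (a 0F &_) (R 0F)) (lookup-lincomb₂ (a ∘ suc) (R ∘ suc) m))

rows₂ : ∀ {k n} → IMat k n → Fin k → BWord n
rows₂ G i = mod2 (lookup G i)

mod2-step : ∀ {n} (c : ℤ) (r l : Vec ℤ n)
  → mod2 (zipWith ℤ._+_ (map (c ℤ.*_) r) l) ≡ parityℤ c ·₂ mod2 r ⊻ᵥ mod2 l
mod2-step c [] [] = refl
mod2-step c (x ∷ r) (y ∷ l) = cong₂ _∷_ reduce₂-cx+y (mod2-step c r l)
  where
  open ≡-Reasoning
  reduce₂-cx+y : reduce₂ (c ℤ.* x ℤ.+ y) ≡ parityℤ c & reduce₂ x ⊻ reduce₂ y
  reduce₂-cx+y = begin
    reduce₂ (c ℤ.* x ℤ.+ y)                   ≡⟨ reduce₂≡parityℤ (c ℤ.* x ℤ.+ y) ⟩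
    parityℤ (c ℤ.* x ℤ.+ y)                   ≡⟨ parityℤ-+ (c ℤ.* x) y ⟩
    parityℤ (c ℤ.* x) ⊻ parityℤ y             ≡⟨ cong (_⊻ parityℤ y) (parityℤ-* c x) ⟩
    parityℤ c & parityℤ x ⊻ parityℤ y         ≡⟨ sym (cong₂ (λ u v → parityℤ c & u ⊻ v) (reduce₂≡parityℤ x) (reduce₂≡parityℤ y)) ⟩
    parityℤ c & reduce₂ x ⊻ reduce₂ y         ∎

mod2-lincomb : ∀ {k n} (a : Fin k → ℤ) (G : IMat k n) → mod2 (lincomb a G) ≡ lincomb₂ (parityℤ ∘ a) (rows₂ G)
mod2-lincomb {n = n} a [] = map-replicate _ (+ 0) n
mod2-lincomb a (r ∷ G) = trans (mod2-step (a 0F) r (lincomb (a ∘ suc) G)) (cong (parityℤ (a 0F) ·₂ mod2 r ⊻ᵥ_) (mod2-lincomb (a ∘ suc) G))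

parityℤ-+toℕ : ∀ (b : Z₂) → parityℤ (+ toℕ b) ≡ b
parityℤ-+toℕ 0F = refl
parityℤ-+toℕ 1F = refl

BinGen⇒lincomb₂ : ∀ {k n} (G : IMat k n) {v} → BinGen G v → ∃ λ c → lincomb₂ c (rows₂ G) ≡ v
BinGen⇒lincomb₂ G (a , e) = parityℤ ∘ a , trans (sym (mod2-lincomb a G)) e

lincomb₂⇒BinGen : ∀ {k n} (G : IMat k n) c → BinGen G (lincomb₂ c (rows₂ G))
lincomb₂⇒BinGen G c = (λ i → + toℕ (c i)) , trans (mod2-lincomb _ G) (lincomb₂-cong (parityℤ-+toℕ ∘ c) (λ _ → refl))

RowsIndep₂⇒lincomb₂-injective : ∀ {k n} (G : IMat k n) → RowsIndep₂ G
  → ∀ c → lincomb₂ c (rows₂ G) ≡ zero₂ → ∀ i → c i ≡ 0F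
RowsIndep₂⇒lincomb₂-injective G indep c e i = +toℕ-even (c i) (indep _ (trans (proj₂ (lincomb₂⇒BinGen G c)) e) i)
  where
  +toℕ-even : ∀ b → (+ toℕ b) %ℕ 2 ≡ 0 → b ≡ 0F
  +toℕ-even 0F _ = refl
  +toℕ-even 1F ()

_⊙_ : ∀ {n} → Z₂ → QWord n → QWord n
0F ⊙ x = zero₄
1F ⊙ x = x

π-⊙ : ∀ {n} b (x : QWord n) → π (b ⊙ x) ≡ b ·₂ π x
π-⊙ 0F x = trans π-zero₄ (sym (·₂-zero (π x)))
π-⊙ 1F x = sym (·₂-one (π x))

ι-·₂-zero : ∀ {n} (v : BWord n) → ι (0F ·₂ v) ≡ zero₄
ι-·₂-zero v = trans (cong ι (·₂-zero v)) ι-zero₂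

-- the carry 1 + 1 = 2 of Z₄
⊙-carry : ∀ {n} a b (x : QWord n) → (a ⊙ x) ⊕ (b ⊙ x) ≡ ((a ⊻ b) ⊙ x) ⊕ ι ((a & b) ·₂ π x)
⊙-carry 0F 0F x = cong (zero₄ ⊕_) (sym (ι-·₂-zero (π x)))
⊙-carry 0F 1F x = trans (QW.identityˡ x) (sym (trans (cong (x ⊕_) (ι-·₂-zero (π x))) (QW.identityʳ x)))
⊙-carry 1F 0F x = cong (x ⊕_) (sym (ι-·₂-zero (π x)))
⊙-carry 1F 1F x = trans (⊕-self x) (sym (trans (QW.identityˡ _) (cong ι (·₂-one (π x)))))

qcomb : ∀ {k n} → (Fin k → Z₂) → (Fin k → QWord n) → QWord n
qcomb {zero} a y = zero₄
qcomb {suc k} a y = (a 0F ⊙ y 0F) ⊕ qcomb (a ∘ suc) (y ∘ suc)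

qcomb-cong : ∀ {k n} {a b : Fin k → Z₂} {y z : Fin k → QWord n}
  → (∀ i → a i ≡ b i) → (∀ i → y i ≡ z i) → qcomb a y ≡ qcomb b z
qcomb-cong {zero} ea ey = refl
qcomb-cong {suc k} ea ey = cong₂ _⊕_ (cong₂ _⊙_ (ea 0F) (ey 0F)) (qcomb-cong (ea ∘ suc) (ey ∘ suc))

qcomb-zero : ∀ {k n} (y : Fin k → QWord n) → qcomb (λ _ → 0F) y ≡ zero₄
qcomb-zero {zero} y = refl
qcomb-zero {suc k} y = trans (QW.identityˡ _) (qcomb-zero (y ∘ suc))

qcomb-e₂ : ∀ {k n} (i : Fin k) (y : Fin k → QWord n) → qcomb (e₂ i) y ≡ y i
qcomb-e₂ zero y = trans (cong (y 0F ⊕_) (qcomb-zero (y ∘ suc))) (QW.identityʳ (y 0F))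
qcomb-e₂ (suc i) y = trans (QW.identityˡ _) (qcomb-e₂ i (y ∘ suc))

π-qcomb : ∀ {k n} (a : Fin k → Z₂) (y : Fin k → QWord n) → π (qcomb a y) ≡ lincomb₂ a (π ∘ y)
π-qcomb {zero} a y = π-zero₄
π-qcomb {suc k} a y = trans (π-⊕ (a 0F ⊙ y 0F) _) (cong₂ _⊻ᵥ_ (π-⊙ (a 0F) (y 0F)) (π-qcomb (a ∘ suc) (y ∘ suc)))

qcomb-carry : ∀ {k n} (a b : Fin k → Z₂) (y : Fin k → QWord n)
  → qcomb a y ⊕ qcomb b y ≡ qcomb (λ i → a i ⊻ b i) y ⊕ ι (lincomb₂ (λ i → a i & b i) (π ∘ y))
qcomb-carry {zero} a b y = trans (QW.identityˡ zero₄) (sym (trans (cong (zero₄ ⊕_) ι-zero₂) (QW.identityˡ zero₄)))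
qcomb-carry {suc k} {n} a b y = begin
  (a₀ ⊕ as) ⊕ (b₀ ⊕ bs)                  ≡⟨ QWS.interchange a₀ as b₀ bs ⟩
  (a₀ ⊕ b₀) ⊕ (as ⊕ bs)                  ≡⟨ cong₂ _⊕_ (⊙-carry (a 0F) (b 0F) (y 0F)) (qcomb-carry (a ∘ suc) (b ∘ suc) (y ∘ suc)) ⟩
  (s₀ ⊕ ι c₀) ⊕ (ss ⊕ ι cs)              ≡⟨ QWS.interchange s₀ (ι c₀) ss (ι cs) ⟩
  (s₀ ⊕ ss) ⊕ (ι c₀ ⊕ ι cs)              ≡⟨ cong ((s₀ ⊕ ss) ⊕_) (sym (ι-⊻ᵥ c₀ cs)) ⟩
  (s₀ ⊕ ss) ⊕ ι (c₀ ⊻ᵥ cs)               ∎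
  where
  open ≡-Reasoning
  a₀ b₀ as bs s₀ ss : QWord n
  c₀ cs : BWord n
  a₀ = a 0F ⊙ y 0F
  b₀ = b 0F ⊙ y 0F
  as = qcomb (a ∘ suc) (y ∘ suc)
  bs = qcomb (b ∘ suc) (y ∘ suc)
  s₀ = (a 0F ⊻ b 0F) ⊙ y 0F
  ss = qcomb (λ i → a (suc i) ⊻ b (suc i)) (y ∘ suc)
  c₀ = (a 0F & b 0F) ·₂ π (y 0F)
  cs = lincomb₂ (λ i → a (suc i) & b (suc i)) (π ∘ y ∘ suc)

qcomb-closed : ∀ {k n} (P : QWord n → Set) → P zero₄ → (∀ x y → P x → P y → P (x ⊕ y))
  → ∀ (a : Fin k → Z₂) {y} → (∀ i → P (y i)) → P (qcomb a y)
qcomb-closed {zero} P p0 p+ a py = p0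
qcomb-closed {suc k} P p0 p+ a {y} py = p+ _ _ (⊙-closed (a 0F)) (qcomb-closed P p0 p+ (a ∘ suc) (py ∘ suc))
  where
  ⊙-closed : ∀ b → P (b ⊙ y 0F)
  ⊙-closed 0F = p0
  ⊙-closed 1F = py 0F

scalar-closed : ∀ {n} (P : QWord n → Set) → P zero₄ → (∀ x y → P x → P y → P (x ⊕ y))
  → ∀ a x → P x → P (a · x)
scalar-closed P p0 p+ a x px = closed a
  where
  step : ∀ b → P (b · x) → P ((b +₄ 1F) · x)
  step b pb = subst P (sym (·-suc b x)) (p+ x _ px pb)
  closed₀ : P (0F · x)
  closed₀ = subst P (sym (·-zero x)) p0
  closed : ∀ a → P (a · x)
  closed 0F = closed₀
  closed 1F = step 0F closed₀
  closed 2F = step 1F (step 0F closed₀)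
  closed 3F = step 2F (step 1F (step 0F closed₀))

-- the d with x = q + 2d, when x ≡ q mod 2
halfDiff : ∀ {n} → QWord n → QWord n → BWord n
halfDiff x q = halfᵥ (x ⊕ negᵥ q)

module _ {n : ℕ} where

  ι-halfDiff : ∀ {x q : QWord n} → π x ≡ π q → ι (halfDiff x q) ≡ x ⊕ negᵥ q
  ι-halfDiff {x} {q} e = π≡0⇒ι∘halfᵥ _ (begin
    π (x ⊕ negᵥ q)       ≡⟨ π-⊕ x (negᵥ q) ⟩
    π x ⊻ᵥ π (negᵥ q)    ≡⟨ cong₂ _⊻ᵥ_ e (π-negᵥ q) ⟩
    π q ⊻ᵥ π q           ≡⟨ ⊻ᵥ-self (π q) ⟩
    zero₂                ∎)
    where open ≡-Reasoning

  +ι-halfDiff : ∀ {x q : QWord n} → π x ≡ π q → q ⊕ ι (halfDiff x q) ≡ x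
  +ι-halfDiff {x} {q} e = trans (cong (q ⊕_) (ι-halfDiff e)) (trans (sym (QW.assoc q x (negᵥ q))) (QWP.xyx⁻¹≈y q x))

  halfDiff-+ι : ∀ (q : QWord n) d → halfDiff (q ⊕ ι d) q ≡ d
  halfDiff-+ι q d = trans (cong halfᵥ (QWP.xyx⁻¹≈y q (ι d))) (halfᵥ∘ι d)

  ι-halfDiff-∈ : ∀ {C : QCode n} → IsQuaternaryCode C → ∀ {x q} → x ∈Q C → q ∈Q C → π x ≡ π q
    → ι (halfDiff x q) ∈Q C
  ι-halfDiff-∈ {C} (_ , C-+ , C-·) {x} {q} x∈C q∈C e =
    subst (_∈Q C) (sym (ι-halfDiff e)) (C-+ x (negᵥ q) x∈C (subst (_∈Q C) (sym (negᵥ≡3· q)) (C-· 3F q q∈C)))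

sum₂-zero : ∀ {k} {g : Fin k → Z₂} → (∀ i → g i ≡ 0F) → sum₂ g ≡ 0F
sum₂-zero {zero} _ = refl
sum₂-zero {suc k} g≡0 = cong₂ _⊻_ (g≡0 0F) (sum₂-zero (g≡0 ∘ suc))

sum₂-select : ∀ {k} (f : Fin k → Z₂) i {g} → (∀ i' → g i' ≡ f i' & e₂ i' i) → sum₂ g ≡ f i
sum₂-select f zero g≡ = trans
  (cong₂ _⊻_ (trans (g≡ 0F) (&-identityʳ (f 0F))) (sum₂-zero (λ i' → trans (g≡ (suc i')) (&-zeroʳ (f (suc i'))))))
  (⊻-identityʳ (f 0F))
sum₂-select f (suc i) g≡ = cong₂ _⊻_ (trans (g≡ 0F) (&-zeroʳ (f 0F))) (sum₂-select (f ∘ suc) i (g≡ ∘ suc))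

reduce₂∘δ : ∀ {k} (i' i : Fin k) → reduce₂ (δ i' i) ≡ e₂ i' i
reduce₂∘δ zero zero = refl
reduce₂∘δ zero (suc i) = refl
reduce₂∘δ (suc i') zero = refl
reduce₂∘δ (suc i') (suc i) = reduce₂∘δ i' i

replicate-++ : ∀ {X : Set} m n (x : X) → replicate m x ++ replicate n x ≡ replicate (m + n) x
replicate-++ zero n x = refl
replicate-++ (suc m) n x = cong (x ∷_) (replicate-++ m n x)

module GeneratorMatrices {j r k₂ : ℕ} (A : Fin j → Fin r → ℤ) (B : Fin k₂ → Fin r → ℤ) where

  N : ℕ
  N = suc (j + r)

  R₁ : Fin (suc j) → BWord N
  R₁ = rows₂ (G₁ A)

  Rᴮ : Fin k₂ → BWord N
  Rᴮ i = rows₂ (G₂ A B) (suc j ↑ʳ i)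

  enc₁ : (Fin (suc j) → Z₂) → BWord N
  enc₁ c = lincomb₂ c R₁

  encB : (Fin k₂ → Z₂) → BWord N
  encB s = lincomb₂ s Rᴮ

  R₁-0≡π-ones₄ : R₁ 0F ≡ π ones₄
  R₁-0≡π-ones₄ = begin
    1F ∷ map reduce₂ (replicate j (+ 1) ++ replicate r (+ 1))                 ≡⟨ cong (1F ∷_) (map-++ reduce₂ (replicate j (+ 1)) _) ⟩
    1F ∷ map reduce₂ (replicate j (+ 1)) ++ map reduce₂ (replicate r (+ 1))   ≡⟨ cong (1F ∷_) (cong₂ _++_ (map-replicate reduce₂ (+ 1) j) (map-replicate reduce₂ (+ 1) r)) ⟩
    1F ∷ replicate j 1F ++ replicate r 1F                                    ≡⟨ cong (1F ∷_) (replicate-++ j r 1F) ⟩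
    replicate N 1F                                                           ≡⟨ sym (map-replicate _ 1F N) ⟩
    π ones₄                                                                  ∎
    where open ≡-Reasoning

  lincomb₂-G₂ : ∀ a → lincomb₂ a (rows₂ (G₂ A B)) ≡ enc₁ (λ i → a (i ↑ˡ k₂)) ⊻ᵥ encB (λ i → a (suc j ↑ʳ i))
  lincomb₂-G₂ a = trans (lincomb₂-++ {suc j} {k₂} a (rows₂ (G₂ A B)))
    (cong (_⊻ᵥ encB (λ i → a (suc j ↑ʳ i)))
      (lincomb₂-cong {a = λ i → a (i ↑ˡ k₂)} {R = λ i → rows₂ (G₂ A B) (i ↑ˡ k₂)} {S = R₁} (λ _ → refl) (λ i → cong mod2 (lookup-++ˡ (G₁ A) _ i))))

  BinGen₁⇒enc₁ : ∀ {v} → BinGen (G₁ A) v → ∃ λ c → enc₁ c ≡ v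
  BinGen₁⇒enc₁ = BinGen⇒lincomb₂ (G₁ A)

  enc₁⇒BinGen₁ : ∀ c → BinGen (G₁ A) (enc₁ c)
  enc₁⇒BinGen₁ = lincomb₂⇒BinGen (G₁ A)

  BinGen₂⇒enc : ∀ {v} → BinGen (G₂ A B) v → ∃₂ λ c s → enc₁ c ⊻ᵥ encB s ≡ v
  BinGen₂⇒enc v∈C₂ with BinGen⇒lincomb₂ (G₂ A B) v∈C₂
  ... | a , e = (λ i → a (i ↑ˡ k₂)) , (λ i → a (suc j ↑ʳ i)) , trans (sym (lincomb₂-G₂ a)) e

  enc-lincomb₂ : ∀ c s → lincomb₂ (c Vector.++ s) (rows₂ (G₂ A B)) ≡ enc₁ c ⊻ᵥ encB s
  enc-lincomb₂ c s = trans (lincomb₂-G₂ (c Vector.++ s))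
    (cong₂ _⊻ᵥ_ (lincomb₂-cong {R = R₁} (++ᶠ-↑ˡ c s) (λ _ → refl)) (lincomb₂-cong {R = Rᴮ} (++ᶠ-↑ʳ c s) (λ _ → refl)))

  enc⇒BinGen₂ : ∀ c s → BinGen (G₂ A B) (enc₁ c ⊻ᵥ encB s)
  enc⇒BinGen₂ c s = subst (BinGen (G₂ A B)) (enc-lincomb₂ c s) (lincomb₂⇒BinGen (G₂ A B) (c Vector.++ s))

  encB-independent : RowsIndep₂ (G₂ A B) → ∀ c s → enc₁ c ⊻ᵥ encB s ≡ zero₂ → ∀ i → s i ≡ 0F
  encB-independent indep c s e i = trans (sym (++ᶠ-↑ʳ c s i))
    (RowsIndep₂⇒lincomb₂-injective (G₂ A B) indep (c Vector.++ s) (trans (enc-lincomb₂ c s) e) (suc j ↑ʳ i))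

  -- G₁ is systematic: its column 0 is (1, 0, …, 0)ᵀ and its column 1 + i, for i < j, is (1, eᵢ)ᵀ,
  -- so these coordinates of enc₁ c determine c.
  coefficients : BWord N → Fin (suc j) → Z₂
  coefficients v 0F = lookup v 0F
  coefficients v (suc i) = lookup v 0F ⊻ lookup v (suc (i ↑ˡ r))

  lookup-R₁-0 : ∀ i' → lookup (R₁ i') 0F ≡ e₂ i' 0F
  lookup-R₁-0 0F = refl
  lookup-R₁-0 (suc i') = cong (λ row → lookup (mod2 row) 0F) (lookup∘tabulate _ i')

  lookup-R₁-top : ∀ i → lookup (R₁ 0F) (suc (i ↑ˡ r)) ≡ 1F
  lookup-R₁-top i = begin
    lookup (R₁ 0F) (suc (i ↑ˡ r))                                       ≡⟨ lookup-map (i ↑ˡ r) reduce₂ (replicate j (+ 1) ++ replicate r (+ 1)) ⟩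
    reduce₂ (lookup (replicate j (+ 1) ++ replicate r (+ 1)) (i ↑ˡ r))  ≡⟨ cong reduce₂ (lookup-++ˡ (replicate j (+ 1)) _ i) ⟩
    reduce₂ (lookup (replicate j (+ 1)) i)                              ≡⟨ cong reduce₂ (lookup-replicate i (+ 1)) ⟩
    1F                                                                  ∎
    where open ≡-Reasoning
  lookup-R₁-identity : ∀ i' i → lookup (R₁ (suc i')) (suc (i ↑ˡ r)) ≡ e₂ i' i
  lookup-R₁-identity i' i = begin
    lookup (R₁ (suc i')) (suc (i ↑ˡ r))                                 ≡⟨ cong (λ row → lookup (mod2 row) (suc (i ↑ˡ r))) (lookup∘tabulate _ i') ⟩
    lookup (mod2 (+ 0 ∷ tabulate (δ i') ++ tabulate (A i'))) (suc (i ↑ˡ r))  ≡⟨ lookup-map (i ↑ˡ r) reduce₂ (tabulate (δ i') ++ tabulate (A i')) ⟩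
    reduce₂ (lookup (tabulate (δ i') ++ tabulate (A i')) (i ↑ˡ r))       ≡⟨ cong reduce₂ (lookup-++ˡ (tabulate (δ i')) _ i) ⟩
    reduce₂ (lookup (tabulate (δ i')) i)                                ≡⟨ cong reduce₂ (lookup∘tabulate (δ i') i) ⟩
    reduce₂ (δ i' i)                                                    ≡⟨ reduce₂∘δ i' i ⟩
    e₂ i' i                                                             ∎
    where open ≡-Reasoning

  coefficients-enc₁ : ∀ c i → coefficients (enc₁ c) i ≡ c i
  coefficients-enc₁ c 0F = trans (lookup-lincomb₂ c R₁ 0F) (sum₂-select c 0F (λ i' → cong (c i' &_) (lookup-R₁-0 i')))
  coefficients-enc₁ c (suc i) = begin
    lookup (enc₁ c) 0F ⊻ lookup (enc₁ c) m                              ≡⟨ cong₂ _⊻_ (coefficients-enc₁ c 0F) (lookup-lincomb₂ c R₁ m) ⟩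
    c 0F ⊻ (c 0F & lookup (R₁ 0F) m ⊻ sum₂ (λ i' → c (suc i') & lookup (R₁ (suc i')) m))
                                                                        ≡⟨ cong (c 0F ⊻_) (cong₂ _⊻_ top rest) ⟩
    c 0F ⊻ (c 0F ⊻ c (suc i))                                           ≡⟨ ⊻-cancelˡ (c 0F) (c (suc i)) ⟩
    c (suc i)                                                           ∎
    where
    open ≡-Reasoning
    m : Fin N
    m = suc (i ↑ˡ r)
    top : c 0F & lookup (R₁ 0F) m ≡ c 0F
    top = trans (cong (c 0F &_) (lookup-R₁-top i)) (&-identityʳ (c 0F))
    rest : sum₂ (λ i' → c (suc i') & lookup (R₁ (suc i')) m) ≡ c (suc i)
    rest = sum₂-select (c ∘ suc) i (λ i' → cong (c (suc i') &_) (lookup-R₁-identity i' i))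

  coefficients-zero₂ : ∀ i → coefficients zero₂ i ≡ 0F
  coefficients-zero₂ 0F = refl
  coefficients-zero₂ (suc i) = lookup-replicate (i ↑ˡ r) 0F

module Parametrisation {j r k₂ : ℕ} (A : Fin j → Fin r → ℤ) (B : Fin k₂ → Fin r → ℤ)
  (C′ : QCode (suc (j + r))) (C′-code : IsQuaternaryCode C′)
  (C′-even : IsEven C′) (C′-π : πImage≡ C′ (BinGen (G₁ A))) (C′-ι : ιPreimage≡ C′ (BinGen (G₂ A B))) (ones∈C′ : ones₄ ∈Q C′)
  where

  open GeneratorMatrices A B

  C₁ C₂ : BCode N
  C₁ = BinGen (G₁ A)
  C₂ = BinGen (G₂ A B)

  R₁∈C₁ : ∀ i → C₁ (R₁ i)
  R₁∈C₁ i = subst C₁ (lincomb₂-e₂ i R₁) (enc₁⇒BinGen₁ (e₂ i))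

  enc₁∈C₂ : ∀ c → C₂ (enc₁ c)
  enc₁∈C₂ c = subst C₂ (trans (cong (enc₁ c ⊻ᵥ_) (lincomb₂-zero Rᴮ)) (BW.identityʳ (enc₁ c))) (enc⇒BinGen₂ c (λ _ → 0F))

  encB∈C₂ : ∀ s → C₂ (encB s)
  encB∈C₂ s = subst C₂ (trans (cong (_⊻ᵥ encB s) (lincomb₂-zero R₁)) (BW.identityˡ (encB s))) (enc⇒BinGen₂ (λ _ → 0F) s)

  lifting : ∀ i → ∃ λ x → x ∈Q C′ × π x ≡ R₁ (suc i)
  lifting i = proj₂ (C′-π (R₁ (suc i))) (R₁∈C₁ (suc i))

  lift : Fin j → QWord N
  lift i = proj₁ (lifting i)

  lift∈C′ : ∀ i → lift i ∈Q C′
  lift∈C′ i = proj₁ (proj₂ (lifting i))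

  π-lift : ∀ i → π (lift i) ≡ R₁ (suc i)
  π-lift i = proj₂ (proj₂ (lifting i))

  Table : Set
  Table = Fin j → Fin k₂ → Z₂

  gens : Table → Fin (suc j) → QWord N
  gens t 0F = ones₄
  gens t (suc i) = lift i ⊕ ι (encB (t i))

  π-gens : ∀ t i → π (gens t i) ≡ R₁ i
  π-gens t 0F = sym R₁-0≡π-ones₄
  π-gens t (suc i) = trans (π-⊕ (lift i) _) (trans (cong₂ _⊻ᵥ_ (π-lift i) (π∘ι _)) (BW.identityʳ _))

  gens∈C′ : ∀ t i → gens t i ∈Q C′
  gens∈C′ t 0F = ones∈C′
  gens∈C′ t (suc i) = proj₁ (proj₂ C′-code) _ _ (lift∈C′ i) (proj₂ (C′-ι _) (encB∈C₂ (t i)))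

  Q : Table → (Fin (suc j) → Z₂) → QWord N
  Q t a = qcomb a (gens t)

  π-Q : ∀ t a → π (Q t a) ≡ enc₁ a
  π-Q t a = trans (π-qcomb a (gens t)) (lincomb₂-cong {a = a} {R = π ∘ gens t} (λ _ → refl) (π-gens t))

  π-Q⊕ι : ∀ t a v → π (Q t a ⊕ ι v) ≡ enc₁ a
  π-Q⊕ι t a v = begin
    π (Q t a ⊕ ι v)         ≡⟨ π-⊕ (Q t a) (ι v) ⟩
    π (Q t a) ⊻ᵥ π (ι v)    ≡⟨ cong₂ _⊻ᵥ_ (π-Q t a) (π∘ι v) ⟩
    enc₁ a ⊻ᵥ zero₂         ≡⟨ BW.identityʳ (enc₁ a) ⟩
    enc₁ a                  ∎
    where open ≡-Reasoning

  Generated : Table → QWord N → Set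
  Generated t x = ∃₂ λ a w → Q t a ⊕ ι (enc₁ w) ≡ x

  coefficients-Generated : ∀ t a w {x} → Q t a ⊕ ι (enc₁ w) ≡ x → ∀ i → coefficients (π x) i ≡ a i
  coefficients-Generated t a w refl i = trans (cong (λ v → coefficients v i) (π-Q⊕ι t a (enc₁ w))) (coefficients-enc₁ a i)

  -- The coefficients of a generated word x are read off π x, then those of its even part x − Q t a.
  normalForm : Table → QWord N → QWord N
  normalForm t x = Q t a ⊕ ι (enc₁ (coefficients (halfDiff x (Q t a))))
    where
    a : Fin (suc j) → Z₂
    a = coefficients (π x)

  normalForm-Generated : ∀ {t x} → Generated t x → normalForm t x ≡ x
  normalForm-Generated {t} (a , w , refl) = cong₂ (λ q v → q ⊕ ι v) Q≡ enc₁≡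
    where
    x : QWord N
    x = Q t a ⊕ ι (enc₁ w)
    Q≡ : Q t (coefficients (π x)) ≡ Q t a
    Q≡ = qcomb-cong {y = gens t} (coefficients-Generated t a w refl) (λ _ → refl)
    halfDiff≡ : halfDiff x (Q t (coefficients (π x))) ≡ enc₁ w
    halfDiff≡ = trans (cong (halfDiff x) Q≡) (halfDiff-+ι (Q t a) (enc₁ w))
    enc₁≡ : enc₁ (coefficients (halfDiff x (Q t (coefficients (π x))))) ≡ enc₁ w
    enc₁≡ = lincomb₂-cong {R = R₁} (λ i → trans (cong (λ v → coefficients v i) halfDiff≡) (coefficients-enc₁ w i)) (λ _ → refl)

  code : Table → QCode N
  code t x = does (≡-dec _≟_ (normalForm t x) x)

  code-complete : ∀ {t x} → Generated t x → x ∈Q code t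
  code-complete {t} {x} g = dec-true (≡-dec _≟_ (normalForm t x) x) (normalForm-Generated g)

  code-sound : ∀ {t x} → x ∈Q code t → Generated t x
  code-sound {t} {x} x∈ with ≡-dec _≟_ (normalForm t x) x
  ... | yes nf≡x = coefficients (π x) , coefficients (halfDiff x (Q t (coefficients (π x)))) , nf≡x

  ι-enc₁-zero : ι (enc₁ (λ _ → 0F)) ≡ zero₄
  ι-enc₁-zero = trans (cong ι (lincomb₂-zero R₁)) ι-zero₂

  Generated-Q : ∀ t a → Generated t (Q t a)
  Generated-Q t a = a , (λ _ → 0F) , trans (cong (Q t a ⊕_) ι-enc₁-zero) (QW.identityʳ (Q t a))

  Generated-ι : ∀ t w → Generated t (ι (enc₁ w))
  Generated-ι t w = (λ _ → 0F) , w , trans (cong (_⊕ ι (enc₁ w)) (qcomb-zero (gens t))) (QW.identityˡ _)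

  Generated-gens : ∀ t i → Generated t (gens t i)
  Generated-gens t i = subst (Generated t) (qcomb-e₂ i (gens t)) (Generated-Q t (e₂ i))

  Generated-zero : ∀ t → Generated t zero₄
  Generated-zero t = subst (Generated t) ι-enc₁-zero (Generated-ι t (λ _ → 0F))

  Generated-⊕ : ∀ t x y → Generated t x → Generated t y → Generated t (x ⊕ y)
  Generated-⊕ t _ _ (a , w , refl) (b , v , refl) = a⊻b , carry⊻w⊻v , sym (begin
    (Q t a ⊕ ι (enc₁ w)) ⊕ (Q t b ⊕ ι (enc₁ v))           ≡⟨ QWS.interchange (Q t a) _ (Q t b) _ ⟩
    (Q t a ⊕ Q t b) ⊕ (ι (enc₁ w) ⊕ ι (enc₁ v))           ≡⟨ cong₂ _⊕_ (qcomb-carry a b (gens t)) (sym (ι-⊻ᵥ (enc₁ w) (enc₁ v))) ⟩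
    (Q t a⊻b ⊕ ι carry) ⊕ ι (enc₁ w ⊻ᵥ enc₁ v)            ≡⟨ QW.assoc (Q t a⊻b) (ι carry) _ ⟩
    Q t a⊻b ⊕ (ι carry ⊕ ι (enc₁ w ⊻ᵥ enc₁ v))            ≡⟨ cong (Q t a⊻b ⊕_) (sym (ι-⊻ᵥ carry _)) ⟩
    Q t a⊻b ⊕ ι (carry ⊻ᵥ (enc₁ w ⊻ᵥ enc₁ v))             ≡⟨ cong (λ u → Q t a⊻b ⊕ ι u) (cong₂ _⊻ᵥ_ carry≡ (sym (lincomb₂-⊻ w v R₁))) ⟩
    Q t a⊻b ⊕ ι (enc₁ a&b ⊻ᵥ enc₁ (λ i → w i ⊻ v i))      ≡⟨ cong (λ u → Q t a⊻b ⊕ ι u) (sym (lincomb₂-⊻ a&b (λ i → w i ⊻ v i) R₁)) ⟩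
    Q t a⊻b ⊕ ι (enc₁ carry⊻w⊻v)                          ∎)
    where
    open ≡-Reasoning
    a⊻b a&b carry⊻w⊻v : Fin (suc j) → Z₂
    a⊻b i = a i ⊻ b i
    a&b i = a i & b i
    carry⊻w⊻v i = a&b i ⊻ (w i ⊻ v i)
    carry : BWord N
    carry = lincomb₂ a&b (π ∘ gens t)
    carry≡ : carry ≡ enc₁ a&b
    carry≡ = lincomb₂-cong {a = a&b} (λ _ → refl) (π-gens t)

  Generated⊆ : ∀ {t} {C : QCode N} → IsQuaternaryCode C → (∀ i → gens t i ∈Q C) → (∀ w → ι (enc₁ w) ∈Q C)
    → ∀ {x} → Generated t x → x ∈Q C
  Generated⊆ {t} {C} (C-zero , C-⊕ , _) gens∈C ι-enc₁∈C (a , w , refl) =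
    C-⊕ _ _ (qcomb-closed (_∈Q C) C-zero C-⊕ a gens∈C) (ι-enc₁∈C w)

  code-isQuaternaryCode : ∀ t → IsQuaternaryCode (code t)
  code-isQuaternaryCode t =
      code-complete (Generated-zero t)
    , (λ x y x∈ y∈ → code-complete (Generated-⊕ t x y (code-sound x∈) (code-sound y∈)))
    , (λ a x x∈ → code-complete (scalar-closed (Generated t) (Generated-zero t) (Generated-⊕ t) a x (code-sound x∈)))

  code⊆C′ : ∀ t → code t ⊆Q C′
  code⊆C′ t x x∈ = Generated⊆ C′-code (gens∈C′ t) (λ w → proj₂ (C′-ι (enc₁ w)) (enc₁∈C₂ w)) (code-sound x∈)

  π-code : ∀ t → πImage≡ (code t) C₁
  π-code t v = (λ { (x , x∈ , refl) → π∈C₁ (code-sound x∈) }) , preimage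
    where
    π∈C₁ : ∀ {x} → Generated t x → C₁ (π x)
    π∈C₁ (a , w , refl) = subst C₁ (sym (π-Q⊕ι t a (enc₁ w))) (enc₁⇒BinGen₁ a)
    preimage : C₁ v → ∃ λ x → x ∈Q code t × π x ≡ v
    preimage v∈ with BinGen₁⇒enc₁ v∈
    ... | c , refl = Q t c , code-complete (Generated-Q t c) , π-Q t c

  ι-code : ∀ t → ιPreimage≡ (code t) C₁
  ι-code t v = (λ ιv∈ → ι⁻¹∈C₁ (code-sound ιv∈)) , ι⁻¹
    where
    ι⁻¹∈C₁ : Generated t (ι v) → C₁ v
    ι⁻¹∈C₁ (a , w , e) = subst C₁ (ι-injective ι-enc₁≡ιv) (enc₁⇒BinGen₁ w)
      where
      a≡0 : ∀ i → a i ≡ 0F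
      a≡0 i = trans (sym (coefficients-Generated t a w e i)) (trans (cong (λ u → coefficients u i) (π∘ι v)) (coefficients-zero₂ i))
      ι-enc₁≡ιv : ι (enc₁ w) ≡ ι v
      ι-enc₁≡ιv = trans (sym (QW.identityˡ _)) (trans (cong (_⊕ ι (enc₁ w)) (sym (trans (qcomb-cong {y = gens t} a≡0 (λ _ → refl)) (qcomb-zero (gens t))))) e)
    ι⁻¹ : C₁ v → ι v ∈Q code t
    ι⁻¹ v∈ with BinGen₁⇒enc₁ v∈
    ... | w , refl = code-complete (Generated-ι t w)

  code∈Y : ∀ t → InY C₁ C₁ (code t)
  code∈Y t = code-isQuaternaryCode t , (λ x x∈ → C′-even x (code⊆C′ t x x∈)) , π-code t , ι-code t
           , code-complete (Generated-gens t 0F)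

  _≗₂_ : Table → Table → Set
  t ≗₂ t' = ∀ i p → t i p ≡ t' i p

  Q-cong : ∀ {t t'} → t ≗₂ t' → ∀ a → Q t a ≡ Q t' a
  Q-cong {t} {t'} t≗t' a = qcomb-cong {a = a} (λ _ → refl) gens≡
    where
    gens≡ : ∀ i → gens t i ≡ gens t' i
    gens≡ 0F = refl
    gens≡ (suc i) = cong (λ v → lift i ⊕ ι v) (lincomb₂-cong {R = Rᴮ} (t≗t' i) (λ _ → refl))

  code-cong : ∀ {t t'} → t ≗₂ t' → code t ≐ code t'
  code-cong t≗t' x = cong (λ q → does (≡-dec _≟_ (q ⊕ ι (enc₁ (coefficients (halfDiff x q)))) x)) (Q-cong t≗t' (coefficients (π x)))

  -- gens t (1 + i) ∈ code t' gives gens t (1 + i) = gens t' (1 + i) + 2 enc₁ w, so encB (tᵢ − t'ᵢ) ∈ 𝒞₁,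
  -- which the independence of the rows of G₂ only allows for tᵢ = t'ᵢ.
  code-injective : RowsIndep₂ (G₂ A B) → ∀ t t' → code t ≐ code t' → t ≗₂ t'
  code-injective indep t t' eq i p with code-sound {t'} (trans (sym (eq (gens t (suc i)))) (code-complete (Generated-gens t (suc i))))
  ... | a , w , e = ⊻≡0⇒≡ (encB-independent indep w _ difference≡0 p)
    where
    a≡e₂ : ∀ i' → a i' ≡ e₂ (suc i) i'
    a≡e₂ i' = begin
      a i'                                  ≡⟨ sym (coefficients-Generated t' a w e i') ⟩
      coefficients (π (gens t (suc i))) i'  ≡⟨ cong (λ v → coefficients v i') (trans (π-gens t (suc i)) (sym (lincomb₂-e₂ (suc i) R₁))) ⟩
      coefficients (enc₁ (e₂ (suc i))) i'   ≡⟨ coefficients-enc₁ (e₂ (suc i)) i' ⟩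
      e₂ (suc i) i'                         ∎
      where open ≡-Reasoning
    Q≡ : Q t' a ≡ lift i ⊕ ι (encB (t' i))
    Q≡ = trans (qcomb-cong {y = gens t'} a≡e₂ (λ _ → refl)) (qcomb-e₂ (suc i) (gens t'))
    encB≡ : encB (t' i) ⊻ᵥ enc₁ w ≡ encB (t i)
    encB≡ = ι-injective (QWP.∙-cancelˡ (lift i) _ _ (begin
      lift i ⊕ ι (encB (t' i) ⊻ᵥ enc₁ w)           ≡⟨ cong (lift i ⊕_) (ι-⊻ᵥ (encB (t' i)) (enc₁ w)) ⟩
      lift i ⊕ (ι (encB (t' i)) ⊕ ι (enc₁ w))      ≡⟨ sym (QW.assoc (lift i) _ _) ⟩
      (lift i ⊕ ι (encB (t' i))) ⊕ ι (enc₁ w)      ≡⟨ cong (_⊕ ι (enc₁ w)) (sym Q≡) ⟩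
      Q t' a ⊕ ι (enc₁ w)                          ≡⟨ e ⟩
      lift i ⊕ ι (encB (t i))                      ∎))
      where open ≡-Reasoning
    difference≡0 : enc₁ w ⊻ᵥ encB (λ p → t i p ⊻ t' i p) ≡ zero₂
    difference≡0 = begin
      enc₁ w ⊻ᵥ encB (λ p → t i p ⊻ t' i p)             ≡⟨ cong (enc₁ w ⊻ᵥ_) (lincomb₂-⊻ (t i) (t' i) Rᴮ) ⟩
      enc₁ w ⊻ᵥ (encB (t i) ⊻ᵥ encB (t' i))             ≡⟨ cong (λ v → enc₁ w ⊻ᵥ (v ⊻ᵥ encB (t' i))) (sym encB≡) ⟩
      enc₁ w ⊻ᵥ ((encB (t' i) ⊻ᵥ enc₁ w) ⊻ᵥ encB (t' i)) ≡⟨ cong (enc₁ w ⊻ᵥ_) (BWP.xyx⁻¹≈y (encB (t' i)) (enc₁ w)) ⟩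
      enc₁ w ⊻ᵥ enc₁ w                                   ≡⟨ ⊻ᵥ-self (enc₁ w) ⟩
      zero₂                                              ∎
      where open ≡-Reasoning

  module _ {C : QCode N} (C∈Y : InY C₁ C₁ C) (C⊆C′ : C ⊆Q C′) where

    private
      C-code : IsQuaternaryCode C
      C-code = proj₁ C∈Y
      C-⊕ : ∀ x y → x ∈Q C → y ∈Q C → (x ⊕ y) ∈Q C
      C-⊕ = proj₁ (proj₂ C-code)
      C-π : πImage≡ C C₁
      C-π = proj₁ (proj₂ (proj₂ C∈Y))
      C-ι : ιPreimage≡ C C₁
      C-ι = proj₁ (proj₂ (proj₂ (proj₂ C∈Y)))
      ones∈C : ones₄ ∈Q C
      ones∈C = proj₂ (proj₂ (proj₂ (proj₂ C∈Y)))

    -- A lift z ∈ C of row 1 + i differs from lift i by 2 d with d ∈ 𝒞₂, d = enc₁ c + encB s;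
    -- then lift i + 2 encB s = z + 2 enc₁ c ∈ C.
    corrected-lift : ∀ i → ∃ λ s → (lift i ⊕ ι (encB s)) ∈Q C
    corrected-lift i = s , subst (_∈Q C) z⊕ι≡ (C-⊕ z _ z∈C (proj₂ (C-ι (enc₁ c)) (enc₁⇒BinGen₁ c)))
      where
      z-found : ∃ λ z → z ∈Q C × π z ≡ R₁ (suc i)
      z-found = proj₂ (C-π (R₁ (suc i))) (R₁∈C₁ (suc i))
      z : QWord N
      z = proj₁ z-found
      z∈C : z ∈Q C
      z∈C = proj₁ (proj₂ z-found)
      πz≡ : π z ≡ π (lift i)
      πz≡ = trans (proj₂ (proj₂ z-found)) (sym (π-lift i))
      d : BWord N
      d = halfDiff z (lift i)
      d-decomposed : ∃₂ λ c s → enc₁ c ⊻ᵥ encB s ≡ d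
      d-decomposed = BinGen₂⇒enc (proj₁ (C′-ι d) (ι-halfDiff-∈ C′-code (C⊆C′ z z∈C) (lift∈C′ i) πz≡))
      c : Fin (suc j) → Z₂
      c = proj₁ d-decomposed
      s : Fin k₂ → Z₂
      s = proj₁ (proj₂ d-decomposed)
      z⊕ι≡ : z ⊕ ι (enc₁ c) ≡ lift i ⊕ ι (encB s)
      z⊕ι≡ = begin
        z ⊕ ι (enc₁ c)                          ≡⟨ cong (_⊕ ι (enc₁ c)) (sym (+ι-halfDiff πz≡)) ⟩
        (lift i ⊕ ι d) ⊕ ι (enc₁ c)             ≡⟨ QW.assoc (lift i) (ι d) _ ⟩
        lift i ⊕ (ι d ⊕ ι (enc₁ c))             ≡⟨ cong (lift i ⊕_) (sym (ι-⊻ᵥ d (enc₁ c))) ⟩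
        lift i ⊕ ι (d ⊻ᵥ enc₁ c)                ≡⟨ cong (λ v → lift i ⊕ ι (v ⊻ᵥ enc₁ c)) (sym (proj₂ (proj₂ d-decomposed))) ⟩
        lift i ⊕ ι (enc₁ c ⊻ᵥ encB s ⊻ᵥ enc₁ c)  ≡⟨ cong (λ v → lift i ⊕ ι v) (BWP.xyx⁻¹≈y (enc₁ c) (encB s)) ⟩
        lift i ⊕ ι (encB s)                     ∎
        where open ≡-Reasoning

    table : Table
    table i = proj₁ (corrected-lift i)

    gens∈C : ∀ i → gens table i ∈Q C
    gens∈C 0F = ones∈C
    gens∈C (suc i) = proj₂ (corrected-lift i)

    C⊆Generated : ∀ {x} → x ∈Q C → Generated table x
    C⊆Generated {x} x∈C = a , w , trans (cong (λ v → Q table a ⊕ ι v) (proj₂ w-found)) (+ι-halfDiff πx≡)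
      where
      a-found : ∃ λ a → enc₁ a ≡ π x
      a-found = BinGen₁⇒enc₁ (proj₁ (C-π (π x)) (x , x∈C , refl))
      a : Fin (suc j) → Z₂
      a = proj₁ a-found
      πx≡ : π x ≡ π (Q table a)
      πx≡ = trans (sym (proj₂ a-found)) (sym (π-Q table a))
      Q∈C : Q table a ∈Q C
      Q∈C = qcomb-closed (_∈Q C) (proj₁ C-code) C-⊕ a gens∈C
      w-found : ∃ λ w → enc₁ w ≡ halfDiff x (Q table a)
      w-found = BinGen₁⇒enc₁ (proj₁ (C-ι _) (ι-halfDiff-∈ C-code x∈C Q∈C πx≡))
      w : Fin (suc j) → Z₂
      w = proj₁ w-found

    code-table≐C : code table ≐ C
    code-table≐C x = ⇔→≡ {z = true} (mk⇔
      (λ x∈ → Generated⊆ C-code gens∈C (λ w → proj₂ (C-ι (enc₁ w)) (enc₁⇒BinGen₁ w)) (code-sound x∈))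
      (λ x∈C → code-complete (C⊆Generated x∈C)))

HasCard-via : ∀ {n m} {T : Set} (_≈_ : T → T → Set) {P : QCode n → Set}
  (enum : Fin m → T) → (∀ i i' → enum i ≈ enum i' → i ≡ i') → (∀ t → ∃ λ i → enum i ≈ t)
  → (F : T → QCode n) → (∀ {t t'} → t ≈ t' → F t ≐ F t') → (∀ t t' → F t ≐ F t' → t ≈ t')
  → (∀ t → P (F t)) → (∀ C → P C → ∃ λ t → F t ≐ C)
  → HasCard P m
HasCard-via _≈_ enum enum-injective enum-surjective F F-cong F-injective F∈P F-surjective =
  F ∘ enum , F∈P ∘ enum , (λ i i' Fi≐Fi' → enum-injective i i' (F-injective (enum i) (enum i') Fi≐Fi')) , enumerated
  where
  enumerated : ∀ C → _ → ∃ λ i → F (enum i) ≐ C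
  enumerated C C∈P with F-surjective C C∈P
  ... | t , Ft≐C with enum-surjective t
  ... | i , enum-i≈t = i , λ x → trans (F-cong enum-i≈t x) (Ft≐C x)

funToFin-cong : ∀ {m n} {f g : Fin m → Fin n} → (∀ q → f q ≡ g q) → funToFin f ≡ funToFin g
funToFin-cong {zero} f≗g = refl
funToFin-cong {suc m} f≗g = cong₂ combine (f≗g zero) (funToFin-cong (f≗g ∘ suc))

module _ {j k l : ℕ} where

  matrix : Fin (l ^ (j * k)) → Fin j → Fin k → Fin l
  matrix idx a b = finToFun idx (combine a b)

  matrix-injective : ∀ idx idx' → (∀ a b → matrix idx a b ≡ matrix idx' a b) → idx ≡ idx'
  matrix-injective idx idx' eq = trans (sym (funToFin-finToFin {j * k} {l} idx)) (trans (funToFin-cong entries≡) (funToFin-finToFin {j * k} {l} idx'))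
    where
    entries≡ : ∀ q → finToFun idx q ≡ finToFun idx' q
    entries≡ q = subst (λ q → finToFun idx q ≡ finToFun idx' q) (combine-remQuot {j} k q) (uncurry eq (remQuot {j} k q))

  matrix-surjective : ∀ (M : Fin j → Fin k → Fin l) → ∃ λ idx → ∀ a b → matrix idx a b ≡ M a b
  matrix-surjective M = funToFin (uncurry M ∘ remQuot k) , λ a b →
    trans (finToFun-funToFin (uncurry M ∘ remQuot k) (combine a b)) (cong (uncurry M) (remQuot-combine a b))

lemma5p5 : (j r k₂ : ℕ) (A : Fin j → Fin r → ℤ) (B : Fin k₂ → Fin r → ℤ)
    → 8 ∣ suc (j + r)
    → suc j ≤ suc (j + r) / 2
    → (∀ v → BinGen (G₁ A) v → BinGen (G₂ A B) v)
    → ⊆Dual (BinGen (G₂ A B)) (BinGen (G₁ A))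
    → RowsIndep₂ (G₁ A)
    → RowsIndep₂ (G₂ A B)
    → (∀ v → BinGen (G₁ A) v → 4 ∣ wtH v)
    → (C′ : QCode (suc (j + r)))
    → InY (BinGen (G₁ A)) (BinGen (G₂ A B)) C′
    → HasCard (λ C → InY (BinGen (G₁ A)) (BinGen (G₁ A)) C × C ⊆Q C′) (2 ^ (j * k₂))
lemma5p5 j r k₂ A B _ _ _ _ _ indep₂ _ C′ (C′-code , C′-even , C′-π , C′-ι , ones∈C′) =
  HasCard-via _≗₂_ matrix matrix-injective matrix-surjective code code-cong (code-injective indep₂)
    (λ t → code∈Y t , code⊆C′ t)
    (λ C (C∈Y , C⊆C′) → table C∈Y C⊆C′ , code-table≐C C∈Y C⊆C′)
  where open Parametrisation A B C′ C′-code C′-even C′-π C′-ι ones∈C′
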